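{- Let $G$ be a finite group with identity $e$ and $S\subseteq G\setminus\{e\}$ with $S=S^{ -1}$. If the Cayley graph $\mathrm{Cay}(G,S)$ is connected, non-complete, and has a regular clique, then it has diameter two.
   Context: All graphs are finite, undirected and simple. The Cayley graph $\mathrm{Cay}(G,S)$ has vertex set $G$, with $x\sim y$ iff $xy^{ -1}\in S$. A clique $C$ is regular with nexus $a$, where $a\ge 1$, if every vertex outside $C$ is adjacent to exactly $a$ vertices of $C$. -}

module Defs where

open import Level using (0ℓ)
open import Data.Nat using (ℕ; zero; suc; _≤_)
open import Data.Fin using (Fin)
open import Data.Fin.Subset using (Subset; _∈_; _∉_; _∩_; ∣_∣)
open import Data.Vec using (tabulate; lookup)
open import Data.Product using (Σ; ∃; _×_; _,_)
open import Relation.Binary.PropositionalEquality using (_≡_; _≢_)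
open import Relation.Nullary using (¬_)
open import Algebra.Core using (Op₁; Op₂)
open import Algebra.Structures using (IsGroup)

-- A finite group: carrier Fin n (n elements), with equality _≡_.
-- Every finite group is isomorphic to one of this form.
record FiniteGroup : Set where
  field
    n       : ℕ
    _∙_     : Op₂ (Fin n)
    ε       : Fin n
    _⁻¹     : Op₁ (Fin n)
    isGroup : IsGroup _≡_ _∙_ ε _⁻¹
  infixl 7 _∙_
  infix 8 _⁻¹

module _ (G : FiniteGroup) where
  open FiniteGroup G

  ValidConnectionSet : Subset n → Set
  ValidConnectionSet S = (ε ∉ S) × (∀ x → x ∈ S → x ⁻¹ ∈ S)

  Adj : Subset n → Fin n → Fin n → Set
  Adj S x y = (x ∙ y ⁻¹) ∈ S

  Nbhd : Subset n → Fin n → Subset n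
  Nbhd S x = tabulate (λ y → lookup S (x ∙ y ⁻¹))

  data Walk (S : Subset n) : ℕ → Fin n → Fin n → Set where
    here : ∀ {x} → Walk S zero x x
    step : ∀ {k x y z} → Adj S x y → Walk S k y z → Walk S (suc k) x z

  Connected : Subset n → Set
  Connected S = ∀ x y → ∃ λ k → Walk S k x y

  NonComplete : Subset n → Set
  NonComplete S = Σ (Fin n) λ x → Σ (Fin n) λ y → x ≢ y × ¬ Adj S x y

  DistLe : Subset n → ℕ → Fin n → Fin n → Set
  DistLe S d x y = ∃ λ k → k ≤ d × Walk S k x y

  DiameterTwo : Subset n → Set
  DiameterTwo S = (∀ x y → DistLe S 2 x y)
                × (Σ (Fin n) λ x → Σ (Fin n) λ y → ¬ DistLe S 1 x y)

  IsClique : Subset n → Subset n → Set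
  IsClique S C = ∀ x y → x ∈ C → y ∈ C → x ≢ y → Adj S x y

  IsRegularCliqueWithNexus : Subset n → Subset n → ℕ → Set
  IsRegularCliqueWithNexus S C a =
    IsClique S C × 1 ≤ a × (∀ v → v ∉ C → ∣ C ∩ Nbhd S v ∣ ≡ a)

  HasRegularClique : Subset n → Set
  HasRegularClique S = Σ (Subset n) λ C → Σ ℕ λ a → IsRegularCliqueWithNexus S C a

-- Right multiplication by any h is an automorphism of Cay(G,S), and it moves
-- any vertex into a given nonempty clique C. So it suffices that every vertex
-- c of C is within distance two of every y: if y ∈ C it is adjacent or equal
-- to c, and otherwise the nexus a ≥ 1 gives y a neighbour c' in C, which is c
-- or adjacent to c. Non-completeness supplies a pair at distance exactly two.
module Submission where

open import Defs
open import Level using (0ℓ)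
open import Data.Nat using (ℕ; _≤_; z≤n; s≤s)
open import Data.Nat.Properties using (≤-refl)
open import Data.Fin using (_≟_)
open import Data.Fin.Subset using (Subset; inside; _∈_; _∉_; _∩_; ∣_∣; Nonempty)
open import Data.Fin.Subset.Properties using (_∈?_; nonempty?; Empty-unique; ∣⊥∣≡0; x∈p∩q⁻)
open import Data.Vec using (lookup)
open import Data.Vec.Properties using (lookup∘tabulate; []=⇒lookup; lookup⇒[]=)
open import Data.Product using (∃; _×_; _,_; proj₁; proj₂)
open import Relation.Binary.PropositionalEquality
open import Relation.Nullary using (¬_; yes; no)
open import Algebra.Bundles using (Group)
import Algebra.Properties.Group as GroupProperties

1≤∣p∣⇒Nonempty : ∀ {m} (p : Subset m) → 1 ≤ ∣ p ∣ → Nonempty p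
1≤∣p∣⇒Nonempty {m} p 1≤∣p∣ with nonempty? p
... | yes p≢∅ = p≢∅
... | no p≡∅ with subst (1 ≤_) (trans (cong ∣_∣ (Empty-unique p≡∅)) (∣⊥∣≡0 m)) 1≤∣p∣
...   | ()

module CayleyGraph (G : FiniteGroup) (S : Subset (FiniteGroup.n G)) where
  open FiniteGroup G

  group : Group 0ℓ 0ℓ
  group = record { isGroup = isGroup }

  open Group group using (_\\_; assoc; inverseʳ; identityˡ)
  open GroupProperties group
    using (\\-leftDividesˡ; //-rightDividesʳ; ⁻¹-anti-homo-∙; ⁻¹-involutive)

  Symmetric : Set
  Symmetric = ∀ x → x ∈ S → x ⁻¹ ∈ S

  Adj-sym : Symmetric → ∀ {u v} → Adj G S u v → Adj G S v u
  Adj-sym S⁻¹⊆S {u} {v} uv = subst (_∈ S) uv⁻¹≡vu⁻¹ (S⁻¹⊆S _ uv)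
    where
    uv⁻¹≡vu⁻¹ : (u ∙ v ⁻¹) ⁻¹ ≡ v ∙ u ⁻¹
    uv⁻¹≡vu⁻¹ = trans (⁻¹-anti-homo-∙ u (v ⁻¹)) (cong (_∙ u ⁻¹) (⁻¹-involutive v))

  ∈Nbhd⇒Adj : ∀ {v c} → c ∈ Nbhd G S v → Adj G S v c
  ∈Nbhd⇒Adj {v} {c} c∈N = lookup⇒[]= _ S (begin
    lookup S (v ∙ c ⁻¹)    ≡⟨ lookup∘tabulate (λ y → lookup S (v ∙ y ⁻¹)) c ⟨
    lookup (Nbhd G S v) c  ≡⟨ []=⇒lookup c∈N ⟩
    inside                 ∎)
    where open ≡-Reasoning

  ∙ʳ-∙⁻¹ : ∀ u v h → (u ∙ h) ∙ (v ∙ h) ⁻¹ ≡ u ∙ v ⁻¹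
  ∙ʳ-∙⁻¹ u v h = begin
    (u ∙ h) ∙ (v ∙ h) ⁻¹     ≡⟨ cong ((u ∙ h) ∙_) (⁻¹-anti-homo-∙ v h) ⟩
    (u ∙ h) ∙ (h ⁻¹ ∙ v ⁻¹)  ≡⟨ assoc u h _ ⟩
    u ∙ (h ∙ (h ⁻¹ ∙ v ⁻¹))  ≡⟨ cong (u ∙_) (assoc h (h ⁻¹) _) ⟨
    u ∙ ((h ∙ h ⁻¹) ∙ v ⁻¹)  ≡⟨ cong (λ t → u ∙ (t ∙ v ⁻¹)) (inverseʳ h) ⟩
    u ∙ (ε ∙ v ⁻¹)           ≡⟨ cong (u ∙_) (identityˡ _) ⟩
    u ∙ v ⁻¹                 ∎
    where open ≡-Reasoning

  Adj-∙ʳ : ∀ h {u v} → Adj G S u v → Adj G S (u ∙ h) (v ∙ h)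
  Adj-∙ʳ h {u} {v} = subst (_∈ S) (sym (∙ʳ-∙⁻¹ u v h))

  Walk-∙ʳ : ∀ h {k u v} → Walk G S k u v → Walk G S k (u ∙ h) (v ∙ h)
  Walk-∙ʳ h here         = here
  Walk-∙ʳ h (step uw wv) = step (Adj-∙ʳ h uw) (Walk-∙ʳ h wv)

  DistLe-∙ʳ⁻ : ∀ h {d u v} → DistLe G S d (u ∙ h) (v ∙ h) → DistLe G S d u v
  DistLe-∙ʳ⁻ h {u = u} {v} (k , k≤d , walk) =
    k , k≤d , subst₂ (Walk G S k) (//-rightDividesʳ h u) (//-rightDividesʳ h v) (Walk-∙ʳ (h ⁻¹) walk)

  DistLe-fromAnyVertex : ∀ {d} c → (∀ y → DistLe G S d c y) → ∀ x y → DistLe G S d x y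
  DistLe-fromAnyVertex c dist-c x y =
    DistLe-∙ʳ⁻ (x \\ c) (subst (λ t → DistLe G S _ t (y ∙ (x \\ c))) (sym (\\-leftDividesˡ x c)) (dist-c _))

  module _ {C : Subset n} {a : ℕ} (regular : IsRegularCliqueWithNexus G S C a) where
    private
      clique : IsClique G S C
      clique = proj₁ regular

      1≤a : 1 ≤ a
      1≤a = proj₁ (proj₂ regular)

      nexus : ∀ v → v ∉ C → ∣ C ∩ Nbhd G S v ∣ ≡ a
      nexus = proj₂ (proj₂ regular)

    neighbourInClique : ∀ {v} → v ∉ C → ∃ λ c → c ∈ C × Adj G S v c
    neighbourInClique {v} v∉C with 1≤∣p∣⇒Nonempty (C ∩ Nbhd G S v) (subst (1 ≤_) (sym (nexus v v∉C)) 1≤a)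
    ... | (c , c∈C∩N) with x∈p∩q⁻ C _ c∈C∩N
    ...   | (c∈C , c∈N) = c , c∈C , ∈Nbhd⇒Adj c∈N

    regularClique-nonempty : Nonempty C
    regularClique-nonempty with ε ∈? C
    ... | yes ε∈C = ε , ε∈C
    ... | no  ε∉C = let (c , c∈C , _) = neighbourInClique ε∉C in c , c∈C

    regularClique-DistLe₂ : Symmetric → ∀ {c} → c ∈ C → ∀ y → DistLe G S 2 c y
    regularClique-DistLe₂ S⁻¹⊆S {c} c∈C y with y ∈? C
    ... | yes y∈C with c ≟ y
    ...   | yes refl = 0 , z≤n , here
    ...   | no  c≢y  = 1 , s≤s z≤n , step (clique c y c∈C y∈C c≢y) here
    regularClique-DistLe₂ S⁻¹⊆S {c} c∈C y | no y∉C with neighbourInClique y∉C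
    ... | (c′ , c′∈C , yc′) with c ≟ c′
    ...   | yes refl = 1 , s≤s z≤n , step (Adj-sym S⁻¹⊆S yc′) here
    ...   | no  c≢c′ = 2 , ≤-refl , step (clique c c′ c∈C c′∈C c≢c′) (step (Adj-sym S⁻¹⊆S yc′) here)

  ¬DistLe₁ : ∀ {x y} → x ≢ y → ¬ Adj G S x y → ¬ DistLe G S 1 x y
  ¬DistLe₁ x≢y ¬xy (_ , _      , here)
    = x≢y refl
  ¬DistLe₁ x≢y ¬xy (_ , _      , step xy here)
    = ¬xy xy
  ¬DistLe₁ x≢y ¬xy (_ , s≤s () , step _ (step _ _))

mainTheorem6 : (G : FiniteGroup) (S : Subset (FiniteGroup.n G))
    → ValidConnectionSet G S
    → Connected G S
    → NonComplete G S
    → HasRegularClique G S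
    → DiameterTwo G S
mainTheorem6 G S (_ , S⁻¹⊆S) _ (x , y , x≢y , ¬xy) (C , a , regular) =
  let (c , c∈C) = regularClique-nonempty regular
  in DistLe-fromAnyVertex c (regularClique-DistLe₂ regular S⁻¹⊆S c∈C) , x , y , ¬DistLe₁ x≢y ¬xy
  where open CayleyGraph G S
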